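{- Let $b(m)$ denote the minimum number of edges of a rooted brush that is strongly $m$-universal for the class of rooted brushes. Then $b(m)=O(m\ln m)$.
   Context: A rooted tree is a tree with a distinguished vertex, the root. A rooted contraction of a rooted tree $T$ is a rooted tree obtained from $T$ by successively contracting edges (contraction of $\{a,b\}$ merges $a,b$ into one vertex adjacent to all former neighbours of $a$ or $b$), the root of the result being the image of the root of $T$. A rooted brush is a rooted tree in which all vertices of degree greater than $2$ lie on a single path starting at the root. A rooted tree $U$ is strongly $m$-universal for a class $C$ of rooted trees if every rooted tree in $C$ with $m$ edges is a rooted contraction of $U$. -}

module Defs where

open import Data.Nat using (ℕ; zero; suc; _+_)
open import Data.List using (List; []; _∷_; _++_)
open import Data.List.Relation.Unary.All using (All)
open import Data.List.Relation.Binary.Permutation.Propositional using (_↭_)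
open import Relation.Binary.Construct.Closure.ReflexiveTransitive using (Star)
open import Relation.Binary.PropositionalEquality using (_≡_)

-- Child order is irrelevant: it is quotiented
-- out by the permutation step in the contraction relation below.
data RTree : Set where
  node : List RTree → RTree

mutual
  edges : RTree → ℕ
  edges (node ts) = edgesF ts

  edgesF : List RTree → ℕ
  edgesF [] = 0
  edgesF (t ∷ ts) = suc (edges t + edgesF ts)

data _⇝_ : RTree → RTree → Set where
  contract : ∀ {cs ts} → node (node cs ∷ ts) ⇝ node (cs ++ ts)
  perm     : ∀ {ts ss} → ts ↭ ss → node ts ⇝ node ss
  inside   : ∀ {t t' ts} → t ⇝ t' → node (t ∷ ts) ⇝ node (t' ∷ ts)

RootedContraction : RTree → RTree → Set
RootedContraction T U = Star _⇝_ U T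

-- A non-root subtree in which every vertex has at most one child,
-- i.e. all its vertices have degree ≤ 2 in the whole tree.
data Bare : RTree → Set where
  leaf : Bare (node [])
  step : ∀ {t} → Bare t → Bare (node (t ∷ []))

-- Rooted brush: all vertices of degree > 2 lie on a single (downward)
-- path starting at the root.
data Brush : RTree → Set where
  stop : ∀ {ts} → All Bare ts → Brush (node ts)
  go   : ∀ {ts c rest} → ts ↭ (c ∷ rest) → Brush c → All Bare rest → Brush (node ts)

StronglyUniversalBrush : ℕ → RTree → Set
StronglyUniversalBrush m U = ∀ T → Brush T → edges T ≡ m → RootedContraction T U

-- A rooted brush is a word of pieces read down its path: the bare legs hanging
-- from the current path vertex, then a step down to the next path vertex, and so
-- on; its edges are the total weight of the pieces.  The universal brush is a
-- path (the spine) whose i-th vertex carries a bare leg of length r(i), where the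
-- ruler sequence is r₀ = () and r_{j+1} = r_j, 2^{j+1} − 2, r_j.  A word of weight
-- at most 2^{j+1} − 1 is a prefix and a suffix of weight at most 2^j − 1 around a
-- single piece, so by induction it embeds into the two copies of r_j and the
-- middle leg.  Contracting the unused legs and spine edges and shortening the used
-- legs then yields the brush.  The spine for r_j has j·2^j edges, which is
-- O(m log m) for the least j with m < 2^j.
module Submission where

open import Defs
open import Data.Nat
  using (ℕ; zero; suc; _+_; _*_; _^_; _≤_; _<_; _≤′_; z≤n; s≤s; ≤′-reflexive; ≤′-step)
open import Data.Nat.Properties
open import Data.Nat.ListAction using (sum)
open import Data.Nat.ListAction.Properties using (sum-++; sum-↭)
open import Data.Nat.Logarithm using (⌊log₂_⌋; ⌊log₂⌋-mono-≤; ⌊log₂[2^n]⌋≡n)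
open import Data.Nat.Tactic.RingSolver using (solve-∀)
open import Data.Product using (∃-syntax; _×_; _,_)
open import Data.Sum using (_⊎_; inj₁; inj₂)
open import Data.List using (List; []; _∷_; _++_; [_]; map)
open import Data.List.Properties using (++-assoc; ++-identityʳ; map-++)
open import Data.List.Relation.Unary.All using (All; []; _∷_)
open import Data.List.Relation.Binary.Permutation.Propositional
  using (_↭_; ↭-refl; ↭-sym; ↭-swap)
open import Data.List.Relation.Binary.Permutation.Propositional.Properties
  using (shift; ++-comm; map⁺)
open import Relation.Binary.Construct.Closure.ReflexiveTransitive
  using (Star; ε; _◅_; _◅◅_; gmap)
open import Relation.Binary.PropositionalEquality
  using (_≡_; refl; sym; trans; cong; cong₂; subst; subst₂; module ≡-Reasoning)
open import Relation.Nullary using (yes; no)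

infix 4 _⇝*_

_⇝*_ : RTree → RTree → Set
_⇝*_ = Star _⇝_

inside* : ∀ {t t′ ts} → t ⇝* t′ → node (t ∷ ts) ⇝* node (t′ ∷ ts)
inside* {ts = ts} = gmap (λ t → node (t ∷ ts)) inside

edgesF≡sum : ∀ ts → edgesF ts ≡ sum (map (λ t → suc (edges t)) ts)
edgesF≡sum []       = refl
edgesF≡sum (t ∷ ts) = cong (λ e → suc (edges t + e)) (edgesF≡sum ts)

edgesF-↭ : ∀ {ts ss} → ts ↭ ss → edgesF ts ≡ edgesF ss
edgesF-↭ {ts} {ss} ts↭ss = begin
  edgesF ts                                ≡⟨ edgesF≡sum ts ⟩
  sum (map (λ t → suc (edges t)) ts)       ≡⟨ sum-↭ (map⁺ (λ t → suc (edges t)) ts↭ss) ⟩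
  sum (map (λ t → suc (edges t)) ss)       ≡⟨ edgesF≡sum ss ⟨
  edgesF ss                                ∎
  where open ≡-Reasoning

path : ℕ → RTree
path zero    = node []
path (suc n) = node [ path n ]

edges-path : ∀ n → edges (path n) ≡ n
edges-path zero    = refl
edges-path (suc n) = cong suc (trans (+-identityʳ _) (edges-path n))

path-bare : ∀ n → Bare (path n)
path-bare zero    = leaf
path-bare (suc n) = step (path-bare n)

bare⇒path : ∀ {t} → Bare t → ∃[ n ] t ≡ path n
bare⇒path leaf = 0 , refl
bare⇒path (step b) with bare⇒path b
... | n , refl = suc n , refl

all-bare⇒paths : ∀ {ts} → All Bare ts → ∃[ ns ] ts ≡ map path ns
all-bare⇒paths []         = [] , refl
all-bare⇒paths (b ∷ bs) with bare⇒path b | all-bare⇒paths bs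
... | n , refl | ns , refl = n ∷ ns , refl

path-contract : ∀ k → path (suc k) ⇝ path k
path-contract zero    = contract
path-contract (suc k) = contract

drop-path : ∀ k ts → node (path k ∷ ts) ⇝* node ts
drop-path zero    ts = contract ◅ ε
drop-path (suc k) ts = contract ◅ drop-path k ts

shorten-path : ∀ {n k} ts → n ≤ k → node (path k ∷ ts) ⇝* node (path n ∷ ts)
shorten-path ts n≤k = shorten (≤⇒≤′ n≤k)
  where
  shorten : ∀ {n k} → n ≤′ k → node (path k ∷ ts) ⇝* node (path n ∷ ts)
  shorten (≤′-reflexive refl) = ε
  shorten (≤′-step {k} n≤′k)  = inside (path-contract k) ◅ shorten n≤′k

spine : List ℕ → RTree
spine []       = node []
spine (k ∷ ks) = node (path k ∷ spine ks ∷ [])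

spine-brush : ∀ ks → Brush (spine ks)
spine-brush []       = stop []
spine-brush (k ∷ ks) = go (↭-swap _ _ ↭-refl) (spine-brush ks) (path-bare k ∷ [])

spine-vanish : ∀ ks acc → node (spine ks ∷ acc) ⇝* node acc
spine-vanish []       acc = contract ◅ ε
spine-vanish (k ∷ ks) acc = contract ◅ drop-path k (spine ks ∷ acc) ◅◅ spine-vanish ks acc

edges-spine-∷ : ∀ k ks → edges (spine (k ∷ ks)) ≡ 2 + k + edges (spine ks)
edges-spine-∷ k ks =
  cong suc (trans (cong₂ (λ a b → a + suc b) (edges-path k) (+-identityʳ _)) (+-suc k _))

edges-spine-++ : ∀ xs ys → edges (spine (xs ++ ys)) ≡ edges (spine xs) + edges (spine ys)
edges-spine-++ []       ys = refl
edges-spine-++ (k ∷ xs) ys = begin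
  edges (spine (k ∷ xs ++ ys))                    ≡⟨ edges-spine-∷ k (xs ++ ys) ⟩
  2 + k + edges (spine (xs ++ ys))                ≡⟨ cong (2 + k +_) (edges-spine-++ xs ys) ⟩
  2 + k + (edges (spine xs) + edges (spine ys))   ≡⟨ +-assoc (2 + k) _ _ ⟨
  2 + k + edges (spine xs) + edges (spine ys)     ≡⟨ cong (_+ edges (spine ys)) (edges-spine-∷ k xs) ⟨
  edges (spine (k ∷ xs)) + edges (spine ys)       ∎
  where open ≡-Reasoning

data Piece : Set where
  leg  : ℕ → Piece
  down : Piece

-- A piece counts the edge that attaches it to its path vertex.
size : Piece → ℕ
size (leg n) = suc n
size down    = 1

weight : List Piece → ℕ
weight is = sum (map size is)

weight-++ : ∀ is js → weight (is ++ js) ≡ weight is + weight js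
weight-++ is js = trans (cong sum (map-++ size is js)) (sum-++ (map size is) (map size js))

children : List Piece → List RTree
children []           = []
children (leg n ∷ is) = path n ∷ children is
children (down ∷ is)  = [ node (children is) ]

children-legs : ∀ ns → children (map leg ns) ≡ map path ns
children-legs []       = refl
children-legs (n ∷ ns) = cong (path n ∷_) (children-legs ns)

children-legs-++ : ∀ ns js → children (map leg ns ++ js) ≡ map path ns ++ children js
children-legs-++ []       js = refl
children-legs-++ (n ∷ ns) js = cong (path n ∷_) (children-legs-++ ns js)

weight-legs : ∀ ns → weight (map leg ns) ≡ edgesF (map path ns)
weight-legs []       = refl
weight-legs (n ∷ ns) = cong suc (cong₂ _+_ (sym (edges-path n)) (weight-legs ns))

brush-pieces : ∀ {T} → Brush T → ∃[ is ] (node (children is) ⇝* T × weight is ≡ edges T)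
brush-pieces (stop bare) with all-bare⇒paths bare
... | ns , refl =
  map leg ns , subst (λ cs → node cs ⇝* node (map path ns)) (sym (children-legs ns)) ε ,
  weight-legs ns
brush-pieces (go {ts} {c} ts↭ brush bare) with all-bare⇒paths bare | brush-pieces brush
... | ns , refl | is , is⇝c , weight-is = map leg ns ++ down ∷ is , contraction , weight-eq
  where
  contraction : node (children (map leg ns ++ down ∷ is)) ⇝* node ts
  contraction rewrite children-legs-++ ns (down ∷ is) =
    perm (++-comm (map path ns) [ node (children is) ]) ◅ inside* is⇝c ◅◅ perm (↭-sym ts↭) ◅ ε

  weight-eq : weight (map leg ns ++ down ∷ is) ≡ edgesF ts
  weight-eq = begin
    weight (map leg ns ++ down ∷ is)       ≡⟨ weight-++ (map leg ns) (down ∷ is) ⟩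
    weight (map leg ns) + suc (weight is)  ≡⟨ cong₂ (λ a b → a + suc b) (weight-legs ns) weight-is ⟩
    edgesF (map path ns) + suc (edges c)   ≡⟨ +-comm _ (suc (edges c)) ⟩
    edgesF (c ∷ map path ns)               ≡⟨ edgesF-↭ ts↭ ⟨
    edgesF ts                              ∎
    where open ≡-Reasoning

-- A step down is realised by the spine edge into the next spine vertex, whose own
-- leg is then discarded.
data Fits : List Piece → List ℕ → Set where
  end     : ∀ {ks} → Fits [] ks
  skip    : ∀ {is k ks} → Fits is ks → Fits is (k ∷ ks)
  use     : ∀ {n is k ks} → n ≤ k → Fits is ks → Fits (leg n ∷ is) (k ∷ ks)
  descend : ∀ {is k ks} → Fits is ks → Fits (down ∷ is) (k ∷ ks)

fits-skip-all : ∀ ks {is ls} → Fits is ls → Fits is (ks ++ ls)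
fits-skip-all []       f = f
fits-skip-all (k ∷ ks) f = skip (fits-skip-all ks f)

fits-∷ : ∀ {x is k ks} → size x ≤ suc k → Fits is ks → Fits (x ∷ is) (k ∷ ks)
fits-∷ {leg n} (s≤s n≤k) f = use n≤k f
fits-∷ {down}  _         f = descend f

spine-contract : ∀ {is ks} → Fits is ks → node [ spine ks ] ⇝* node (children is)

-- acc holds the children already produced at the current path vertex.
fits-contract : ∀ {is ks} → Fits is ks → ∀ acc → node (spine ks ∷ acc) ⇝* node (children is ++ acc)
fits-contract {ks = ks} end acc = spine-vanish ks acc
fits-contract (skip {k = k} {ks} f) acc =
  contract ◅ drop-path k (spine ks ∷ acc) ◅◅ fits-contract f acc
fits-contract (use {n} {is} {ks = ks} n≤k f) acc =
  contract ◅ shorten-path (spine ks ∷ acc) n≤k ◅◅ perm (↭-swap _ _ ↭-refl) ◅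
  fits-contract f (path n ∷ acc) ◅◅ perm (shift (path n) (children is) acc) ◅ ε
fits-contract (descend {k = k} {ks} f) acc =
  inside* (drop-path k [ spine ks ] ◅◅ spine-contract f)

spine-contract {is} {ks} f =
  subst (λ cs → node [ spine ks ] ⇝* node cs) (++-identityʳ (children is)) (fits-contract f [])

-- Stated with a continuation, so that the legs after ks stay available for the
-- rest of a longer word.
Hosts : ℕ → List ℕ → Set
Hosts w ks = ∀ {is} → weight is ≤ w → ∀ {js ls} → Fits js ls → Fits (is ++ js) (ks ++ ls)

hosts⇒fits : ∀ {w ks is} → Hosts w ks → weight is ≤ w → Fits is ks
hosts⇒fits {ks = ks} {is} hosts is≤w =
  subst₂ Fits (++-identityʳ is) (++-identityʳ ks) (hosts is≤w end)

hosts-[] : Hosts 0 []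
hosts-[] {[]}         _  f = f
hosts-[] {leg _ ∷ _}  ()
hosts-[] {down ∷ _}   ()

weight-split : ∀ w is → weight is ≤ w ⊎
  ∃[ p ] ∃[ x ] ∃[ q ] (is ≡ p ++ x ∷ q × weight p ≤ w × w < weight p + size x)
weight-split w [] = inj₁ z≤n
weight-split w (x ∷ is) with size x ≤? w
... | no  x≰w = inj₂ ([] , x , is , refl , z≤n , ≰⇒> x≰w)
... | yes x≤w with m≤n⇒∃[o]m+o≡n x≤w
...   | w′ , refl with weight-split w′ is
...     | inj₁ is≤w′ = inj₁ (+-monoʳ-≤ (size x) is≤w′)
...     | inj₂ (p , y , q , refl , p≤w′ , w′<p+y) =
  inj₂ (x ∷ p , y , q , refl , +-monoʳ-≤ (size x) p≤w′ ,
        subst (size x + w′ <_) (sym (+-assoc (size x) (weight p) (size y)))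
              (+-monoʳ-< (size x) w′<p+y))

m+n≤1+2w∧w<m⇒n≤w : ∀ {m n w} → m + n ≤ suc (w + w) → w < m → n ≤ w
m+n≤1+2w∧w<m⇒n≤w {n = n} {w} m+n≤ w<m =
  +-cancelˡ-≤ (suc w) n w (≤-trans (+-monoˡ-≤ n w<m) m+n≤)

-- Split the word before the piece that overflows weight w: the prefix goes into
-- the first copy of ks, that piece into the middle leg, the suffix into the second copy.
hosts-double : ∀ {w ks} → Hosts w ks → Hosts (suc (w + w)) (ks ++ (w + w) ∷ ks)
hosts-double {w} {ks} hosts {is} is≤ {js} {ls} f
  rewrite ++-assoc ks ((w + w) ∷ ks) ls with weight-split w is
... | inj₁ is≤w = hosts is≤w (skip (fits-skip-all ks f))
... | inj₂ (p , x , q , refl , p≤w , w<p+x) rewrite ++-assoc p (x ∷ q) js =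
  hosts p≤w (fits-∷ x≤ (hosts q≤w f))
  where
  p+x+q≤ : weight p + (size x + weight q) ≤ suc (w + w)
  p+x+q≤ = subst (_≤ suc (w + w)) (weight-++ p (x ∷ q)) is≤

  q≤w : weight q ≤ w
  q≤w = m+n≤1+2w∧w<m⇒n≤w
    (subst (_≤ suc (w + w)) (sym (+-assoc (weight p) (size x) (weight q))) p+x+q≤) w<p+x

  x≤ : size x ≤ suc (w + w)
  x≤ = ≤-trans (≤-trans (m≤m+n (size x) (weight q)) (m≤n+m _ (weight p))) p+x+q≤

capacity : ℕ → ℕ
capacity zero    = 0
capacity (suc j) = suc (capacity j + capacity j)

suc-capacity : ∀ j → suc (capacity j) ≡ 2 ^ j
suc-capacity zero    = refl
suc-capacity (suc j) = begin
  suc (suc (capacity j + capacity j))   ≡⟨ cong suc (+-suc (capacity j) (capacity j)) ⟨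
  suc (capacity j) + suc (capacity j)   ≡⟨ cong₂ _+_ (suc-capacity j) (suc-capacity j) ⟩
  2 ^ j + 2 ^ j                         ≡⟨ cong (2 ^ j +_) (+-identityʳ (2 ^ j)) ⟨
  2 ^ suc j                             ∎
  where open ≡-Reasoning

ruler : ℕ → List ℕ
ruler zero    = []
ruler (suc j) = ruler j ++ (capacity j + capacity j) ∷ ruler j

ruler-hosts : ∀ j → Hosts (capacity j) (ruler j)
ruler-hosts zero    = hosts-[]
ruler-hosts (suc j) = hosts-double (ruler-hosts j)

edges-spine-ruler : ∀ j → edges (spine (ruler j)) ≡ j * suc (capacity j)
edges-spine-ruler zero    = refl
edges-spine-ruler (suc j) = begin
  edges (spine (ruler j ++ (c + c) ∷ ruler j))         ≡⟨ edges-spine-++ (ruler j) _ ⟩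
  e + edges (spine ((c + c) ∷ ruler j))                ≡⟨ cong (e +_) (edges-spine-∷ (c + c) (ruler j)) ⟩
  e + (2 + (c + c) + e)                                ≡⟨ cong (λ x → x + (2 + (c + c) + x)) (edges-spine-ruler j) ⟩
  j * suc c + (2 + (c + c) + j * suc c)                ≡⟨ doubling j c ⟩
  suc j * suc (suc (c + c))                            ∎
  where
  open ≡-Reasoning
  c = capacity j
  e = edges (spine (ruler j))
  doubling : ∀ j c → j * suc c + (2 + (c + c) + j * suc c) ≡ suc j * suc (suc (c + c))
  doubling = solve-∀

capacity-bracket : ∀ m → ∃[ j ] (2 ^ j ≤ suc m × suc m ≤ capacity (suc j))
capacity-bracket zero = 0 , ≤-refl , ≤-refl
capacity-bracket (suc m) with capacity-bracket m
... | j , 2^j≤ , ≤cap with suc (suc m) ≤? capacity (suc j)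
...   | yes ≤cap′ = j , m≤n⇒m≤1+n 2^j≤ , ≤cap′
...   | no  ≰cap  = suc j , 2^[1+j]≤ , s≤s (≤-trans ≤cap (m≤m+n _ _))
  where
  2^[1+j]≤ : 2 ^ suc j ≤ suc (suc m)
  2^[1+j]≤ = subst (_≤ suc (suc m)) (suc-capacity (suc j)) (≰⇒> ≰cap)

universal : ℕ → RTree
universal j = node [ spine (ruler j) ]

universal-brush : ∀ j → Brush (universal j)
universal-brush j = go ↭-refl (spine-brush (ruler j)) []

universal-universal : ∀ {j m} → m ≤ capacity j → StronglyUniversalBrush m (universal j)
universal-universal {j} m≤ T brush refl with brush-pieces brush
... | is , is⇝T , weight-is =
  spine-contract (hosts⇒fits (ruler-hosts j) (subst (_≤ capacity j) (sym weight-is) m≤)) ◅◅ is⇝T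

edges-universal : ∀ j → edges (universal j) ≡ suc (j * 2 ^ j)
edges-universal j = cong suc (begin
  edges (spine (ruler j)) + 0   ≡⟨ +-identityʳ _ ⟩
  edges (spine (ruler j))       ≡⟨ edges-spine-ruler j ⟩
  j * suc (capacity j)          ≡⟨ cong (j *_) (suc-capacity j) ⟩
  j * 2 ^ j                     ∎)
  where open ≡-Reasoning

edges-universal-≤ : ∀ {m j} → 2 ≤ m → 2 ^ j ≤ m → edges (universal (suc j)) ≤ 5 * m * ⌊log₂ m ⌋
edges-universal-≤ {m} {j} 2≤m 2^j≤m = begin
  edges (universal (suc j))           ≡⟨ edges-universal (suc j) ⟩
  1 + suc j * (2 * 2 ^ j)             ≤⟨ +-mono-≤ 1≤mL (*-mono-≤ 1+j≤2L (*-monoʳ-≤ 2 2^j≤m)) ⟩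
  m * L + (L + L) * (2 * m)           ≡⟨ collect m L ⟩
  5 * m * L                           ∎
  where
  open ≤-Reasoning
  L = ⌊log₂ m ⌋
  1≤L : 1 ≤ L
  1≤L = subst (_≤ L) (⌊log₂[2^n]⌋≡n 1) (⌊log₂⌋-mono-≤ 2≤m)
  1+j≤2L : suc j ≤ L + L
  1+j≤2L = ≤-trans (s≤s (subst (_≤ L) (⌊log₂[2^n]⌋≡n j) (⌊log₂⌋-mono-≤ 2^j≤m))) (+-monoˡ-≤ L 1≤L)
  1≤mL : 1 ≤ m * L
  1≤mL = *-mono-≤ (≤-trans (s≤s z≤n) 2≤m) 1≤L
  collect : ∀ m L → m * L + (L + L) * (2 * m) ≡ 5 * m * L
  collect = solve-∀

theorem4 : ∃[ C ] ∃[ N ] ((m : ℕ) → N ≤ m →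
             ∃[ U ] (Brush U × edges U ≤ C * m * ⌊log₂ m ⌋ × StronglyUniversalBrush m U))
theorem4 = 5 , 2 , brush-of-size
  where
  brush-of-size : ∀ m → 2 ≤ m →
    ∃[ U ] (Brush U × edges U ≤ 5 * m * ⌊log₂ m ⌋ × StronglyUniversalBrush m U)
  brush-of-size (suc m) 2≤m with capacity-bracket m
  ... | j , 2^j≤ , ≤cap =
    universal (suc j) , universal-brush (suc j) , edges-universal-≤ {j = j} 2≤m 2^j≤ ,
    universal-universal {suc j} ≤cap
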